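{- Let $n\ge 0$ and $k\ge 0$ be integers. Let $RA_{n+2,k}$ be the set of permutations $\pi\in\mathcal{Q}_{n+2}$ with $\mathrm{asc}(\pi)=k$ such that, with $a=\pi^{ -1}(1)$, either $a=1$, or $2\le a\le n+1$ and $\pi(a-1)>\pi(a+1)$. Let $HA_{n+1,k-1}$ be the set of pairs $[\sigma,i]$ with $\sigma\in\mathcal{Q}_{n+1}$, $\mathrm{asc}(\sigma)=k-1$, and $i\in\{1,2,\dots,n-k+2\}$. Then there is a bijection from $RA_{n+2,k}$ onto $HA_{n+1,k-1}$.
   Context: Permutations of $[m]=\{1,\dots,m\}$ are written as words $\pi(1)\cdots\pi(m)$. $\mathrm{asc}(\pi)$ is the number of indices $i\in[m-1]$ with $\pi(i)<\pi(i+1)$. $\mathcal{Q}_m$ denotes the set of permutations $\pi$ of $[m]$ such that $\pi(1)<\pi(2)<\cdots<\pi(p)$ where $p=\pi^{ -1}(m)$ (the identity permutation being included). -}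

module Defs where

open import Data.Nat using (ℕ; zero; suc; _+_; _≡ᵇ_; _<ᵇ_; _≤_)
open import Data.Bool using (Bool; true; false; _∧_; _∨_; if_then_else_; T)
open import Data.List using (List; []; _∷_; length; upTo)
open import Data.Product using (Σ; _×_; _,_)

-- Permutations of [m] are represented as words: lists of naturals
-- π(1) ⋯ π(m) with values in {1,…,m}.

occ : ℕ → List ℕ → ℕ
occ j []      = 0
occ j (x ∷ w) = if j ≡ᵇ x then suc (occ j w) else occ j w

allB : (ℕ → Bool) → List ℕ → Bool
allB p []      = true
allB p (x ∷ w) = p x ∧ allB p w

isPerm : ℕ → List ℕ → Bool
isPerm m w = (length w ≡ᵇ m) ∧ allB (λ j → occ (suc j) w ≡ᵇ 1) (upTo m)

asc : List ℕ → ℕ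
asc (x ∷ y ∷ w) = (if x <ᵇ y then 1 else 0) + asc (y ∷ w)
asc _           = 0

-- prefix condition π(1) < ⋯ < π(p) where π(p) = m
incToMax : ℕ → List ℕ → Bool
incToMax m (x ∷ y ∷ w) = if x ≡ᵇ m then true else ((x <ᵇ y) ∧ incToMax m (y ∷ w))
incToMax m _           = true

inQ : ℕ → List ℕ → Bool
inQ m w = isPerm m w ∧ incToMax m w

startsWith1 : List ℕ → Bool
startsWith1 (x ∷ _) = x ≡ᵇ 1
startsWith1 []      = false

valley1 : List ℕ → Bool
valley1 (x ∷ y ∷ z ∷ w) = ((y ≡ᵇ 1) ∧ (z <ᵇ x)) ∨ valley1 (y ∷ z ∷ w)
valley1 _               = false

RA : ℕ → ℕ → Set
RA n k = Σ (List ℕ) λ π →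
  T (inQ (n + 2) π) × T (asc π ≡ᵇ k) × T (startsWith1 π ∨ valley1 π)

-- HA_{n+1,k-1} : pairs [σ, i], σ ∈ 𝒬_{n+1}, asc σ = k - 1 (i.e. asc σ + 1 = k),
-- 1 ≤ i ≤ n - k + 2 (i.e. i + k ≤ n + 2, read over the integers)
HA : ℕ → ℕ → Set
HA n k = Σ (List ℕ × ℕ) λ { (σ , i) →
  T (inQ (n + 1) σ) × T (suc (asc σ) ≡ᵇ k) × 1 ≤ i × i + k ≤ n + 2 }

-- Shift σ ∈ 𝒬_{n+1} up by one and insert a 1: in front if i = 1, and into its (i-1)-st descent
-- (counted from the left) if i ≥ 2.  Either way exactly one ascent is created, the increasing
-- prefix up to the maximum is untouched (descents only occur after it), and an inserted 1 sits
-- between π(a-1) > π(a+1).  Conversely, deleting the 1 of π ∈ RA_{n+2,k} and shifting down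
-- recovers σ, and i is read off from the descents before the 1.  Adjacent letters of a
-- permutation differ, so asc σ + des σ = n and the admissible i are 1 ≤ i ≤ des σ + 1 = n - k + 2.
module Submission where

open import Defs
open import Data.Nat using (ℕ)
open import Function.Bundles using (_⤖_)

open import Data.Bool using (Bool; true; false; _∧_; _∨_; if_then_else_; T)
open import Data.Bool.Properties using (T-∧; T-∨; T-irrelevant)
open import Data.List using (List; []; _∷_; [_]; length; map; upTo)
open import Data.List.Properties using (length-map; map-∘; map-id; map-id-local)
open import Data.List.Relation.Unary.All as All using (All; []; _∷_)
open import Data.List.Relation.Unary.All.Properties using (applyUpTo⁺₁; applyUpTo⁻)
  renaming (map⁺ to All-map⁺)
open import Data.List.Relation.Unary.Linked using (Linked; []; [-]; _∷_)
open import Data.List.Relation.Binary.Permutation.Propositional as ↭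
  using (_↭_; ↭-refl; ↭-prep; ↭-swap; ↭-trans)
open import Data.List.Relation.Binary.Permutation.Propositional.Properties
  using (↭-length; All-resp-↭)
open import Data.Nat using (zero; suc; pred; _+_; _≡ᵇ_; _<ᵇ_; _≤_; _<_; z≤n; s≤s; z<s; s<s; s≤s⁻¹; s<s⁻¹)
open import Data.Nat.Properties
  using ( suc-injective; ≡ᵇ⇒≡; ≡⇒≡ᵇ; <ᵇ⇒<; _<?_; ≤-refl; ≤-reflexive; ≤-trans; ≤-irrelevant
        ; <⇒≤; <⇒≱; ≮⇒≥; 1+n≰n; m≤n+m; m≤n⇒m≤1+n; n<1+n; m<n⇒m<1+n
        ; +-comm; +-suc; +-monoˡ-≤; +-cancelʳ-≤; +-commutativeSemigroup )
open import Algebra.Properties.CommutativeSemigroup +-commutativeSemigroup using (interchange)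
open import Data.Nat.Tactic.RingSolver using (solve-∀)
open import Data.Product using (Σ; _×_; _,_; proj₁; proj₂)
open import Data.Product.Properties using (Σ-≡,≡→≡; ×-≡,≡→≡)
open import Data.Sum using (inj₁; inj₂)
open import Function using (_∘_; id; const; _⇔_; mk⇔)
open import Function.Bundles using (mk↔ₛ′; module Equivalence)
open import Function.Properties.Inverse using (↔⇒⤖)
open import Relation.Binary.PropositionalEquality
  using (_≡_; _≢_; refl; sym; trans; cong; cong₂; subst; module ≡-Reasoning)
open import Relation.Nullary using (yes; no; contradiction; Irrelevant)

open Equivalence using (to; from)

T-allB : ∀ (p : ℕ → Bool) w → T (allB p w) ⇔ All (T ∘ p) w
T-allB p []      = mk⇔ (const []) (const _)
T-allB p (x ∷ w) = mk⇔
  (λ t → let px , pw = to T-∧ t in px ∷ to (T-allB p w) pw)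
  (λ { (px ∷ pw) → from T-∧ (px , from (T-allB p w) pw) })

allB-cong : ∀ {p q : ℕ → Bool} → (∀ x → p x ≡ q x) → ∀ w → allB p w ≡ allB q w
allB-cong p≗q []      = refl
allB-cong p≗q (x ∷ w) = cong₂ _∧_ (p≗q x) (allB-cong p≗q w)

<ᵇ-true : ∀ {m n} → m < n → (m <ᵇ n) ≡ true
<ᵇ-true {zero}  (s≤s _)   = refl
<ᵇ-true {suc m} (s≤s m<n) = <ᵇ-true m<n

<ᵇ-false : ∀ {m n} → n ≤ m → (m <ᵇ n) ≡ false
<ᵇ-false z≤n       = refl
<ᵇ-false (s≤s n≤m) = <ᵇ-false n≤m

index-bound : ∀ {a d n i k} → a + d ≡ n → suc a ≡ k → i ≤ suc d ⇔ i + k ≤ n + 2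
index-bound {a} {d} {n} {i} refl refl =
  subst (λ m → i ≤ suc d ⇔ i + suc a ≤ m) (shift a d)
        (mk⇔ (+-monoˡ-≤ (suc a)) (+-cancelʳ-≤ (suc a) i (suc d)))
  where
  shift : ∀ a d → suc d + suc a ≡ a + d + 2
  shift = solve-∀

restrict-⤖ : ∀ {A B : Set} {P : A → Set} {Q : B → Set} →
             (∀ {a} → Irrelevant (P a)) → (∀ {b} → Irrelevant (Q b)) →
             (f : A → B) (g : B → A) →
             (∀ {a} → P a → Q (f a) × g (f a) ≡ a) →
             (∀ {b} → Q b → P (g b) × f (g b) ≡ b) →
             Σ A P ⤖ Σ B Q
restrict-⤖ {A} {B} {P} {Q} P-irr Q-irr f g f-correct g-correct = ↔⇒⤖ (mk↔ₛ′ f′ g′ f′∘g′ g′∘f′)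
  where
  f′ : Σ A P → Σ B Q
  f′ (a , pa) = f a , proj₁ (f-correct pa)
  g′ : Σ B Q → Σ A P
  g′ (b , qb) = g b , proj₁ (g-correct qb)
  f′∘g′ : ∀ y → f′ (g′ y) ≡ y
  f′∘g′ (b , qb) = Σ-≡,≡→≡ (proj₂ (g-correct qb) , Q-irr _ _)
  g′∘f′ : ∀ x → g′ (f′ x) ≡ x
  g′∘f′ (a , pa) = Σ-≡,≡→≡ (proj₂ (f-correct pa) , P-irr _ _)

occ-∷ : ∀ c x w → occ c (x ∷ w) ≡ occ c [ x ] + occ c w
occ-∷ c x w with c ≡ᵇ x
... | true  = refl
... | false = refl

occ-here : ∀ x w → occ x (x ∷ w) ≡ suc (occ x w)
occ-here x w with x ≡ᵇ x | ≡⇒≡ᵇ x x refl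
... | true | _ = refl

occ-tail : ∀ c x w → occ c w ≤ occ c (x ∷ w)
occ-tail c x w = subst (occ c w ≤_) (sym (occ-∷ c x w)) (m≤n+m _ _)

occ-map-suc : ∀ c σ → occ (suc c) (map suc σ) ≡ occ c σ
occ-map-suc c []      = refl
occ-map-suc c (x ∷ σ) = cong (λ t → if c ≡ᵇ x then suc t else t) (occ-map-suc c σ)

occ-zero : ∀ {w} → All (1 ≤_) w → occ 0 w ≡ 0
occ-zero []            = refl
occ-zero (s≤s _ ∷ w≥1) = occ-zero w≥1

occ-↭ : ∀ {c w w′} → w ↭ w′ → occ c w ≡ occ c w′
occ-↭ ↭.refl               = refl
occ-↭ {c} (↭.prep x w↭w′)  = cong (λ t → if c ≡ᵇ x then suc t else t) (occ-↭ w↭w′)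
occ-↭ {c} (↭.swap x y w↭w′) with c ≡ᵇ x | c ≡ᵇ y
... | true  | true  = cong (suc ∘ suc) (occ-↭ w↭w′)
... | true  | false = cong suc (occ-↭ w↭w′)
... | false | true  = cong suc (occ-↭ w↭w′)
... | false | false = occ-↭ w↭w′
occ-↭ (↭.trans w↭v v↭w′)   = trans (occ-↭ w↭v) (occ-↭ v↭w′)

T-isPerm : ∀ m w → T (isPerm m w) ⇔ (length w ≡ m × (∀ {c} → c < m → occ (suc c) w ≡ 1))
T-isPerm m w = mk⇔
  (λ t → let len , once = to T-∧ t in
     ≡ᵇ⇒≡ _ _ len , λ {c} c<m → ≡ᵇ⇒≡ _ _ (applyUpTo⁻ id m (to (T-allB _ (upTo m)) once) c<m))
  (λ (len , once) → from T-∧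
     ( ≡⇒≡ᵇ _ _ len
     , from (T-allB _ (upTo m)) (applyUpTo⁺₁ id m (λ c<m → ≡⇒≡ᵇ _ _ (once c<m)))))

isPerm-↭ : ∀ {m w w′} → w ↭ w′ → isPerm m w ≡ isPerm m w′
isPerm-↭ {m} w↭w′ =
  cong₂ _∧_ (cong (_≡ᵇ m) (↭-length w↭w′))
            (allB-cong (λ j → cong (_≡ᵇ 1) (occ-↭ w↭w′)) (upTo m))

inRangeCount : ℕ → List ℕ → ℕ
inRangeCount m []          = 0
inRangeCount m (0 ∷ w)     = inRangeCount m w
inRangeCount m (suc x ∷ w) = (if x <ᵇ m then 1 else 0) + inRangeCount m w

≡ᵇ+<ᵇ : ∀ m x → (if m ≡ᵇ x then 1 else 0) + (if x <ᵇ m then 1 else 0) ≡ (if x <ᵇ suc m then 1 else 0)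
≡ᵇ+<ᵇ zero    zero    = refl
≡ᵇ+<ᵇ zero    (suc x) = refl
≡ᵇ+<ᵇ (suc m) zero    = refl
≡ᵇ+<ᵇ (suc m) (suc x) = ≡ᵇ+<ᵇ m x

inRangeCount-zero : ∀ w → inRangeCount 0 w ≡ 0
inRangeCount-zero []          = refl
inRangeCount-zero (0 ∷ w)     = inRangeCount-zero w
inRangeCount-zero (suc x ∷ w) = inRangeCount-zero w

inRangeCount-suc : ∀ m w → inRangeCount (suc m) w ≡ occ (suc m) w + inRangeCount m w
inRangeCount-suc m []          = refl
inRangeCount-suc m (0 ∷ w)     = inRangeCount-suc m w
inRangeCount-suc m (suc x ∷ w) = begin
  (if x <ᵇ suc m then 1 else 0) + inRangeCount (suc m) w
    ≡⟨ cong₂ _+_ (sym (≡ᵇ+<ᵇ m x)) (inRangeCount-suc m w) ⟩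
  ([m≡x] + [x<m]) + (occ (suc m) w + inRangeCount m w)
    ≡⟨ interchange [m≡x] [x<m] (occ (suc m) w) (inRangeCount m w) ⟩
  ([m≡x] + occ (suc m) w) + ([x<m] + inRangeCount m w)
    ≡⟨ cong (_+ ([x<m] + inRangeCount m w)) (sym (occ-∷ (suc m) (suc x) w)) ⟩
  occ (suc m) (suc x ∷ w) + inRangeCount m (suc x ∷ w) ∎
  where
  open ≡-Reasoning
  [m≡x] [x<m] : ℕ
  [m≡x] = if m ≡ᵇ x then 1 else 0
  [x<m] = if x <ᵇ m then 1 else 0

inRangeCount≤length : ∀ m w → inRangeCount m w ≤ length w
inRangeCount≤length m []          = z≤n
inRangeCount≤length m (0 ∷ w)     = m≤n⇒m≤1+n (inRangeCount≤length m w)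
inRangeCount≤length m (suc x ∷ w) with x <ᵇ m
... | true  = s≤s (inRangeCount≤length m w)
... | false = m≤n⇒m≤1+n (inRangeCount≤length m w)

inRangeCount≡length⇒inRange : ∀ m w → inRangeCount m w ≡ length w → All (λ x → 1 ≤ x × x ≤ m) w
inRangeCount≡length⇒inRange m []          _  = []
inRangeCount≡length⇒inRange m (0 ∷ w)     eq =
  contradiction (subst (_≤ length w) eq (inRangeCount≤length m w)) 1+n≰n
inRangeCount≡length⇒inRange m (suc x ∷ w) eq with x <? m
... | yes x<m rewrite <ᵇ-true x<m =
  (s≤s z≤n , x<m) ∷ inRangeCount≡length⇒inRange m w (suc-injective eq)
... | no  x≮m rewrite <ᵇ-false (≮⇒≥ x≮m) =
  contradiction (subst (_≤ length w) eq (inRangeCount≤length m w)) 1+n≰n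

once⇒inRangeCount≡ : ∀ m w → (∀ {c} → c < m → occ (suc c) w ≡ 1) → inRangeCount m w ≡ m
once⇒inRangeCount≡ zero    w _    = inRangeCount-zero w
once⇒inRangeCount≡ (suc m) w once =
  trans (inRangeCount-suc m w)
        (cong₂ _+_ (once (n<1+n m)) (once⇒inRangeCount≡ m w (once ∘ m<n⇒m<1+n)))

isPerm⇒inRange : ∀ {m} w → T (isPerm m w) → All (λ x → 1 ≤ x × x ≤ m) w
isPerm⇒inRange {m} w t =
  let len , once = to (T-isPerm m w) t in
  inRangeCount≡length⇒inRange m w (trans (once⇒inRangeCount≡ m w once) (sym len))

isPerm⇒positive : ∀ {m} w → T (isPerm m w) → All (1 ≤_) w
isPerm⇒positive w = All.map proj₁ ∘ isPerm⇒inRange w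

isPerm-suc⇒≢[] : ∀ {m} w → T (isPerm (suc m) w) → w ≢ []
isPerm-suc⇒≢[] w t refl = t

occ≤1⇒Linked≢ : ∀ {w} → All (λ x → occ x w ≤ 1) w → Linked _≢_ w
occ≤1⇒Linked≢ []                = []
occ≤1⇒Linked≢ (_ ∷ [])          = [-]
occ≤1⇒Linked≢ {x ∷ y ∷ w} (x-once ∷ y-ws-once) =
  x≢y ∷ occ≤1⇒Linked≢ (All.map (≤-trans (occ-tail _ x (y ∷ w))) y-ws-once)
  where
  x≢y : x ≢ y
  x≢y refl with subst (_≤ 1) (trans (occ-here x (x ∷ w)) (cong suc (occ-here x w))) x-once
  ... | s≤s ()

isPerm⇒Linked≢ : ∀ {m} w → T (isPerm m w) → Linked _≢_ w
isPerm⇒Linked≢ {m} w t = occ≤1⇒Linked≢ (All.map once (isPerm⇒inRange w t))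
  where
  once : ∀ {x} → 1 ≤ x × x ≤ m → occ x w ≤ 1
  once (s≤s _ , c<m) = ≤-reflexive (proj₂ (to (T-isPerm m w) t) c<m)

isPerm-1∷map-suc : ∀ {m σ} → T (isPerm (suc m) (1 ∷ map suc σ)) ⇔ T (isPerm m σ)
isPerm-1∷map-suc {m} {σ} = mk⇔
  (λ t → let len , once = to (T-isPerm (suc m) (1 ∷ map suc σ)) t in from (T-isPerm m σ)
     ( suc-injective (trans (cong suc (sym (length-map suc σ))) len)
     , λ {c} c<m → trans (sym (occ-map-suc (suc c) σ)) (once (s<s c<m))))
  (λ t → let len , once = to (T-isPerm m σ) t in from (T-isPerm (suc m) (1 ∷ map suc σ))
     ( cong suc (trans (length-map suc σ) len)
     , λ { {zero} _ → cong suc (trans (occ-map-suc 0 σ) (occ-zero (isPerm⇒positive σ t)))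
         ; {suc c} c<m → trans (occ-map-suc _ σ) (once (s<s⁻¹ c<m)) }))

des : List ℕ → ℕ
des (x ∷ y ∷ w) = (if y <ᵇ x then 1 else 0) + des (y ∷ w)
des _           = 0

≢⇒ascent+descent≡1 : ∀ {x y} → x ≢ y → (if x <ᵇ y then 1 else 0) + (if y <ᵇ x then 1 else 0) ≡ 1
≢⇒ascent+descent≡1 {zero}  {zero}  x≢y = contradiction refl x≢y
≢⇒ascent+descent≡1 {zero}  {suc y} _   = refl
≢⇒ascent+descent≡1 {suc x} {zero}  _   = refl
≢⇒ascent+descent≡1 {suc x} {suc y} x≢y = ≢⇒ascent+descent≡1 (x≢y ∘ cong suc)

asc+des≡length : ∀ {x w} → Linked _≢_ (x ∷ w) → asc (x ∷ w) + des (x ∷ w) ≡ length w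
asc+des≡length [-]           = refl
asc+des≡length {x} {y ∷ w} (x≢y ∷ links) =
  trans (interchange (if x <ᵇ y then 1 else 0) (asc (y ∷ w)) (if y <ᵇ x then 1 else 0) (des (y ∷ w)))
        (cong₂ _+_ (≢⇒ascent+descent≡1 x≢y) (asc+des≡length links))

isPerm⇒asc+des≡ : ∀ {n} σ → T (isPerm (suc n) σ) → asc σ + des σ ≡ n
isPerm⇒asc+des≡ [] ()
isPerm⇒asc+des≡ {n} (x ∷ w) t =
  trans (asc+des≡length (isPerm⇒Linked≢ {suc n} (x ∷ w) t))
        (suc-injective (proj₁ (to (T-isPerm (suc n) (x ∷ w)) t)))

asc-map-suc : ∀ σ → asc (map suc σ) ≡ asc σ
asc-map-suc []          = refl
asc-map-suc (x ∷ [])    = refl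
asc-map-suc (x ∷ y ∷ σ) = cong ((if x <ᵇ y then 1 else 0) +_) (asc-map-suc (y ∷ σ))

des-map-suc : ∀ σ → des (map suc σ) ≡ des σ
des-map-suc []          = refl
des-map-suc (x ∷ [])    = refl
des-map-suc (x ∷ y ∷ σ) = cong ((if y <ᵇ x then 1 else 0) +_) (des-map-suc (y ∷ σ))

incToMax-map-suc : ∀ m σ → incToMax (suc m) (map suc σ) ≡ incToMax m σ
incToMax-map-suc m []          = refl
incToMax-map-suc m (x ∷ [])    = refl
incToMax-map-suc m (x ∷ y ∷ σ) =
  cong (λ b → if x ≡ᵇ m then true else ((x <ᵇ y) ∧ b)) (incToMax-map-suc m (y ∷ σ))

-- Insertion j x u w: w is u with a 1 inserted into the j-th descent (counted from 0) of x ∷ u.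
data Insertion : ℕ → ℕ → List ℕ → List ℕ → Set where
  here         : ∀ {x y u} → y < x → Insertion zero x (y ∷ u) (1 ∷ y ∷ u)
  past-descent : ∀ {j x y u w} → y < x → Insertion j y u w → Insertion (suc j) x (y ∷ u) (y ∷ w)
  past-ascent  : ∀ {j x y u w} → x ≤ y → Insertion j y u w → Insertion j x (y ∷ u) (y ∷ w)

past : ∀ {j x y u w} → Insertion j y u w → Insertion ((if y <ᵇ x then 1 else 0) + j) x (y ∷ u) (y ∷ w)
past {x = x} {y} ins with y <? x
... | yes y<x rewrite <ᵇ-true y<x         = past-descent y<x ins
... | no  y≮x rewrite <ᵇ-false (≮⇒≥ y≮x) = past-ascent (≮⇒≥ y≮x) ins

insert : ℕ → ℕ → List ℕ → List ℕ
insert j       x []      = []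
insert j       x (y ∷ u) with y <? x
insert zero    x (y ∷ u) | yes _ = 1 ∷ y ∷ u
insert (suc j) x (y ∷ u) | yes _ = y ∷ insert j y u
insert j       x (y ∷ u) | no  _ = y ∷ insert j y u

remove1 : List ℕ → List ℕ
remove1 []      = []
remove1 (1 ∷ w) = w
remove1 (y ∷ w) = y ∷ remove1 w

descentsBefore1 : ℕ → List ℕ → ℕ
descentsBefore1 x []      = 0
descentsBefore1 x (1 ∷ w) = 0
descentsBefore1 x (y ∷ w) = (if y <ᵇ x then 1 else 0) + descentsBefore1 y w

insert-Insertion : ∀ j x u → j < des (x ∷ u) → Insertion j x u (insert j x u)
insert-Insertion j x (y ∷ u) j<des with y <? x
insert-Insertion zero    x (y ∷ u) j<des | yes y<x = here y<x
insert-Insertion (suc j) x (y ∷ u) j<des | yes y<x rewrite <ᵇ-true y<x =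
  past-descent y<x (insert-Insertion j y u (s<s⁻¹ j<des))
insert-Insertion j       x (y ∷ u) j<des | no  y≮x rewrite <ᵇ-false (≮⇒≥ y≮x) =
  past-ascent (≮⇒≥ y≮x) (insert-Insertion j y u j<des)

Insertion⇒insert≡ : ∀ {j x u w} → Insertion j x u w → insert j x u ≡ w
Insertion⇒insert≡ (here {x} {y} y<x) with y <? x
... | yes _   = refl
... | no  y≮x = contradiction y<x y≮x
Insertion⇒insert≡ (past-descent {x = x} {y} y<x ins) with y <? x
... | yes _   = cong (y ∷_) (Insertion⇒insert≡ ins)
... | no  y≮x = contradiction y<x y≮x
Insertion⇒insert≡ (past-ascent {x = x} {y} x≤y ins) with y <? x
... | yes y<x = contradiction x≤y (<⇒≱ y<x)
... | no  _   = cong (y ∷_) (Insertion⇒insert≡ ins)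

Insertion⇒<des : ∀ {j x u w} → Insertion j x u w → j < des (x ∷ u)
Insertion⇒<des (here y<x)             rewrite <ᵇ-true y<x  = z<s
Insertion⇒<des (past-descent y<x ins) rewrite <ᵇ-true y<x  = s<s (Insertion⇒<des ins)
Insertion⇒<des (past-ascent x≤y ins)  rewrite <ᵇ-false x≤y = Insertion⇒<des ins

Insertion⇒↭ : ∀ {j x u w} → Insertion j x u w → w ↭ 1 ∷ u
Insertion⇒↭ (here _)                     = ↭-refl
Insertion⇒↭ (past-descent {y = y} _ ins) = ↭-trans (↭-prep y (Insertion⇒↭ ins)) (↭-swap y 1 ↭-refl)
Insertion⇒↭ (past-ascent  {y = y} _ ins) = ↭-trans (↭-prep y (Insertion⇒↭ ins)) (↭-swap y 1 ↭-refl)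

Insertion⇒remove1 : ∀ {j x u w} → All (1 <_) u → Insertion j x u w → remove1 w ≡ u
Insertion⇒remove1 _                    (here _)             = refl
Insertion⇒remove1 (s≤s (s≤s _) ∷ u>1) (past-descent _ ins) = cong (_ ∷_) (Insertion⇒remove1 u>1 ins)
Insertion⇒remove1 (s≤s (s≤s _) ∷ u>1) (past-ascent _ ins)  = cong (_ ∷_) (Insertion⇒remove1 u>1 ins)

Insertion⇒descentsBefore1 : ∀ {j x u w} → All (1 <_) u → Insertion j x u w → descentsBefore1 x w ≡ j
Insertion⇒descentsBefore1 _ (here _) = refl
Insertion⇒descentsBefore1 (s≤s (s≤s _) ∷ u>1) (past-descent y<x ins) rewrite <ᵇ-true y<x =
  cong suc (Insertion⇒descentsBefore1 u>1 ins)
Insertion⇒descentsBefore1 (s≤s (s≤s _) ∷ u>1) (past-ascent x≤y ins) rewrite <ᵇ-false x≤y =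
  Insertion⇒descentsBefore1 u>1 ins

Insertion-asc : ∀ {j x u w} → All (1 <_) u → Insertion j x u w → asc (x ∷ w) ≡ suc (asc (x ∷ u))
Insertion-asc (s≤s (s≤s _) ∷ _) (here y<x@(s≤s _)) rewrite <ᵇ-false (<⇒≤ y<x) = refl
Insertion-asc (_ ∷ u>1) (past-descent _ ins) = trans (cong (_ +_) (Insertion-asc u>1 ins)) (+-suc _ _)
Insertion-asc (_ ∷ u>1) (past-ascent _ ins)  = trans (cong (_ +_) (Insertion-asc u>1 ins)) (+-suc _ _)

Insertion-incToMax : ∀ {M j x u w} → Insertion j x u w → incToMax M (x ∷ w) ≡ incToMax M (x ∷ u)
Insertion-incToMax (here y<x@(s≤s _)) rewrite <ᵇ-false (<⇒≤ y<x) = refl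
Insertion-incToMax {M} {x = x} (past-descent {y = y} _ ins) =
  cong (λ b → if x ≡ᵇ M then true else ((x <ᵇ y) ∧ b)) (Insertion-incToMax ins)
Insertion-incToMax {M} {x = x} (past-ascent {y = y} _ ins) =
  cong (λ b → if x ≡ᵇ M then true else ((x <ᵇ y) ∧ b)) (Insertion-incToMax ins)

valley1-∷ : ∀ x y w → T (valley1 (y ∷ w)) → T (valley1 (x ∷ y ∷ w))
valley1-∷ x y (z ∷ w) v = from T-∨ (inj₂ v)

Insertion-valley1 : ∀ {j x u w} → Insertion j x u w → T (valley1 (x ∷ w))
Insertion-valley1 (here y<x) rewrite <ᵇ-true y<x                = _
Insertion-valley1 (past-descent {x = x} {y} {w = w} _ ins) = valley1-∷ x y w (Insertion-valley1 ins)
Insertion-valley1 (past-ascent  {x = x} {y} {w = w} _ ins) = valley1-∷ x y w (Insertion-valley1 ins)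

valley1⇒1∈ : ∀ x w → T (valley1 (x ∷ w)) → 1 ≤ occ 1 w
valley1⇒1∈ x (1 ∷ z ∷ w)           _ = s≤s z≤n
valley1⇒1∈ x (0 ∷ z ∷ w)           v = valley1⇒1∈ 0 (z ∷ w) v
valley1⇒1∈ x (suc (suc y) ∷ z ∷ w) v = valley1⇒1∈ (suc (suc y)) (z ∷ w) v

valley1⇒Insertion : ∀ x w → T (valley1 (x ∷ w)) → occ 1 w ≤ 1 →
                    Insertion (descentsBefore1 x w) x (remove1 w) w
valley1⇒Insertion x (1 ∷ z ∷ w) v once with to T-∨ v
... | inj₁ z<ᵇx = here (<ᵇ⇒< z x z<ᵇx)
... | inj₂ v′   = contradiction (≤-trans (valley1⇒1∈ 1 (z ∷ w) v′) (s≤s⁻¹ once)) λ ()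
valley1⇒Insertion x (0 ∷ z ∷ w)           v once = past (valley1⇒Insertion 0 (z ∷ w) v once)
valley1⇒Insertion x (suc (suc y) ∷ z ∷ w) v once = past (valley1⇒Insertion (suc (suc y)) (z ∷ w) v once)

data Codes : List ℕ × ℕ → List ℕ → Set where
  initial : ∀ {σ} → Codes (σ , 1) (1 ∷ map suc σ)
  valley  : ∀ {s σ j w} → Insertion j (suc s) (map suc σ) w → Codes (s ∷ σ , 2 + j) (suc s ∷ w)

encode : List ℕ → List ℕ × ℕ
encode []      = [] , 0
encode (1 ∷ w) = map pred w , 1
encode (x ∷ w) = map pred (x ∷ remove1 w) , 2 + descentsBefore1 x w

decode : List ℕ × ℕ → List ℕ
decode (σ , 1)               = 1 ∷ map suc σ
decode (s ∷ σ , suc (suc j)) = suc s ∷ insert j (suc s) (map suc σ)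
decode _                     = []

map-pred-suc : ∀ σ → map pred (map suc σ) ≡ σ
map-pred-suc σ = trans (sym (map-∘ σ)) (map-id σ)

map-suc-pred : ∀ {w} → All (1 ≤_) w → map suc (map pred w) ≡ w
map-suc-pred {w} w≥1 = trans (sym (map-∘ w)) (map-id-local (All.map (λ { (s≤s _) → refl }) w≥1))

map-suc-positive : ∀ {σ} → All (1 ≤_) σ → All (1 <_) (map suc σ)
map-suc-positive σ≥1 = All-map⁺ (All.map s≤s σ≥1)

Codes⇒decode≡ : ∀ {p π} → Codes p π → decode p ≡ π
Codes⇒decode≡ initial              = refl
Codes⇒decode≡ (valley {s = s} ins) = cong (suc s ∷_) (Insertion⇒insert≡ ins)

Codes⇒encode≡ : ∀ {σ i π} → All (1 ≤_) σ → Codes (σ , i) π → encode π ≡ (σ , i)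
Codes⇒encode≡ _ initial = cong (_, 1) (map-pred-suc _)
Codes⇒encode≡ (s≤s _ ∷ σ≥1) (valley {σ = σ} ins) =
  cong₂ (λ τ d → (_ ∷ τ , 2 + d))
    (trans (cong (map pred) (Insertion⇒remove1 (map-suc-positive σ≥1) ins)) (map-pred-suc σ))
    (Insertion⇒descentsBefore1 (map-suc-positive σ≥1) ins)

encode-Codes : ∀ {π} → All (1 ≤_) π → occ 1 π ≤ 1 → T (startsWith1 π ∨ valley1 π) →
               Codes (encode π) π
encode-Codes {1 ∷ w} (_ ∷ w≥1) _ _ =
  subst (λ v → Codes (map pred w , 1) (1 ∷ v)) (map-suc-pred w≥1) initial
encode-Codes {suc (suc x) ∷ w} (_ ∷ w≥1) once v =
  valley (subst (λ u → Insertion (descentsBefore1 (suc (suc x)) w) (suc (suc x)) u w)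
                (sym (map-suc-pred removed≥1)) ins)
  where
  ins : Insertion (descentsBefore1 (suc (suc x)) w) (suc (suc x)) (remove1 w) w
  ins = valley1⇒Insertion (suc (suc x)) w v once
  removed≥1 : All (1 ≤_) (remove1 w)
  removed≥1 with All-resp-↭ (Insertion⇒↭ ins) w≥1
  ... | _ ∷ removed≥1 = removed≥1

decode-Codes : ∀ {σ i} → 1 ≤ i → i ≤ suc (des σ) → Codes (σ , i) (decode (σ , i))
decode-Codes {i = 1}                   _ _           = initial
decode-Codes {s ∷ σ} {i = suc (suc j)} _ (s≤s j<des) =
  valley (insert-Insertion j (suc s) (map suc σ) (subst (j <_) (sym (des-map-suc (s ∷ σ))) j<des))

Codes⇒↭ : ∀ {σ i π} → Codes (σ , i) π → π ↭ 1 ∷ map suc σ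
Codes⇒↭ initial              = ↭-refl
Codes⇒↭ (valley {s = s} ins) = ↭-trans (↭-prep (suc s) (Insertion⇒↭ ins)) (↭-swap (suc s) 1 ↭-refl)

Codes-isPerm : ∀ {m σ i π} → Codes (σ , i) π → T (isPerm (suc m) π) ⇔ T (isPerm m σ)
Codes-isPerm {m} {σ} codes =
  subst (λ b → T b ⇔ T (isPerm m σ)) (sym (isPerm-↭ (Codes⇒↭ codes))) (isPerm-1∷map-suc {m} {σ})

Codes-incToMax : ∀ {m σ i π} → All (1 ≤_) σ → Codes (σ , i) π →
                 incToMax (suc (suc m)) π ≡ incToMax (suc m) σ
Codes-incToMax []                 initial      = refl
Codes-incToMax {m} {σ} (s≤s _ ∷ _) initial      = incToMax-map-suc (suc m) σ
Codes-incToMax {m} {σ} _           (valley ins) = trans (Insertion-incToMax ins) (incToMax-map-suc (suc m) σ)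

Codes-inQ : ∀ {m σ i π} → Codes (σ , i) π → T (inQ (suc (suc m)) π) ⇔ T (inQ (suc m) σ)
Codes-inQ {σ = σ} codes = mk⇔
  (λ t → let π-perm , π-inc = to T-∧ t ; σ-perm = to (Codes-isPerm codes) π-perm in
     from T-∧ (σ-perm , subst T (Codes-incToMax (isPerm⇒positive σ σ-perm) codes) π-inc))
  (λ t → let σ-perm , σ-inc = to T-∧ t in
     from T-∧ ( from (Codes-isPerm codes) σ-perm
              , subst T (sym (Codes-incToMax (isPerm⇒positive σ σ-perm) codes)) σ-inc))

Codes-asc : ∀ {σ i π} → All (1 ≤_) σ → σ ≢ [] → Codes (σ , i) π → asc π ≡ suc (asc σ)
Codes-asc []          σ≢[] initial      = contradiction refl σ≢[]
Codes-asc {σ} (s≤s _ ∷ _) _    initial      = cong suc (asc-map-suc σ)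
Codes-asc {σ} (_ ∷ σ≥1)   _    (valley ins) =
  trans (Insertion-asc (map-suc-positive σ≥1) ins) (cong suc (asc-map-suc σ))

Codes⇒startsWith1∨valley1 : ∀ {p π} → Codes p π → T (startsWith1 π ∨ valley1 π)
Codes⇒startsWith1∨valley1 initial      = _
Codes⇒startsWith1∨valley1 (valley ins) = from T-∨ (inj₂ (Insertion-valley1 ins))

Codes⇒index-bounds : ∀ {σ i π} → Codes (σ , i) π → 1 ≤ i × i ≤ suc (des σ)
Codes⇒index-bounds initial                  = ≤-refl , s≤s z≤n
Codes⇒index-bounds (valley {s = s} {σ} ins) =
  s≤s z≤n , s≤s (subst (_ <_) (des-map-suc (s ∷ σ)) (Insertion⇒<des ins))

-- RA n k and HA n k are Σ (List ℕ) (InRA n k) and Σ (List ℕ × ℕ) (InHA n k) by definition.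
InRA : ℕ → ℕ → List ℕ → Set
InRA n k π = T (inQ (n + 2) π) × T (asc π ≡ᵇ k) × T (startsWith1 π ∨ valley1 π)

InHA : ℕ → ℕ → List ℕ × ℕ → Set
InHA n k (σ , i) = T (inQ (n + 1) σ) × T (suc (asc σ) ≡ᵇ k) × 1 ≤ i × i + k ≤ n + 2

InRA-irrelevant : ∀ n k π → Irrelevant (InRA n k π)
InRA-irrelevant n k π (a , b , c) (a′ , b′ , c′) =
  ×-≡,≡→≡ (T-irrelevant a a′ , ×-≡,≡→≡ (T-irrelevant b b′ , T-irrelevant c c′))

InHA-irrelevant : ∀ n k p → Irrelevant (InHA n k p)
InHA-irrelevant n k p (a , b , c , d) (a′ , b′ , c′ , d′) =
  ×-≡,≡→≡ (T-irrelevant a a′ ,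
  ×-≡,≡→≡ (T-irrelevant b b′ , ×-≡,≡→≡ (≤-irrelevant c c′ , ≤-irrelevant d d′)))

module _ (n k : ℕ) where

  inQ+1⇒isPerm : ∀ σ → T (inQ (n + 1) σ) → T (isPerm (suc n) σ)
  inQ+1⇒isPerm σ rewrite +-comm n 1 = proj₁ ∘ to T-∧

  inQ+2⇒isPerm : ∀ π → T (inQ (n + 2) π) → T (isPerm (suc (suc n)) π)
  inQ+2⇒isPerm π rewrite +-comm n 2 = proj₁ ∘ to T-∧

  Codes⇒π∈Q⇔σ∈Q : ∀ {σ i π} → Codes (σ , i) π → T (inQ (n + 2) π) ⇔ T (inQ (n + 1) σ)
  Codes⇒π∈Q⇔σ∈Q codes rewrite +-comm n 2 | +-comm n 1 = Codes-inQ codes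

  RA⇒Codes : ∀ {π} → InRA n k π → Codes (encode π) π
  RA⇒Codes {π} (π∈Q , _ , shape) =
    encode-Codes (isPerm⇒positive π π-perm) (≤-reflexive occ1≡1) shape
    where
    π-perm : T (isPerm (suc (suc n)) π)
    π-perm = inQ+2⇒isPerm π π∈Q
    occ1≡1 : occ 1 π ≡ 1
    occ1≡1 = proj₂ (to (T-isPerm (suc (suc n)) π) π-perm) z<s

  HA⇒Codes : ∀ {p} → InHA n k p → Codes p (decode p)
  HA⇒Codes {σ , i} (σ∈Q , asc≡k , 1≤i , i+k≤) =
    decode-Codes 1≤i (from bound i+k≤)
    where
    bound : i ≤ suc (des σ) ⇔ i + k ≤ n + 2
    bound = index-bound (isPerm⇒asc+des≡ σ (inQ+1⇒isPerm σ σ∈Q)) (≡ᵇ⇒≡ _ _ asc≡k)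

  Codes⇒InRA⇔InHA : ∀ {σ i π} → Codes (σ , i) π → InRA n k π ⇔ InHA n k (σ , i)
  Codes⇒InRA⇔InHA {σ} {i} {π} codes = mk⇔ InRA⇒InHA InHA⇒InRA
    where
    asc-shift : T (inQ (n + 1) σ) → asc π ≡ suc (asc σ)
    asc-shift σ∈Q = Codes-asc (isPerm⇒positive σ σ-perm) (isPerm-suc⇒≢[] σ σ-perm) codes
      where
      σ-perm : T (isPerm (suc n) σ)
      σ-perm = inQ+1⇒isPerm σ σ∈Q

    InRA⇒InHA : InRA n k π → InHA n k (σ , i)
    InRA⇒InHA (π∈Q , asc≡k , _) = σ∈Q , σ-asc≡k , 1≤i , to bound (proj₂ (Codes⇒index-bounds codes))
      where
      σ∈Q : T (inQ (n + 1) σ)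
      σ∈Q = to (Codes⇒π∈Q⇔σ∈Q codes) π∈Q
      σ-asc≡k : T (suc (asc σ) ≡ᵇ k)
      σ-asc≡k = subst (λ a → T (a ≡ᵇ k)) (asc-shift σ∈Q) asc≡k
      1≤i : 1 ≤ i
      1≤i = proj₁ (Codes⇒index-bounds codes)
      bound : i ≤ suc (des σ) ⇔ i + k ≤ n + 2
      bound = index-bound (isPerm⇒asc+des≡ σ (inQ+1⇒isPerm σ σ∈Q)) (≡ᵇ⇒≡ _ _ σ-asc≡k)

    InHA⇒InRA : InHA n k (σ , i) → InRA n k π
    InHA⇒InRA (σ∈Q , σ-asc≡k , _) =
      from (Codes⇒π∈Q⇔σ∈Q codes) σ∈Q , subst (λ a → T (a ≡ᵇ k)) (sym (asc-shift σ∈Q)) σ-asc≡k ,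
      Codes⇒startsWith1∨valley1 codes

lemma2p8 : (n k : ℕ) → RA n k ⤖ HA n k
lemma2p8 n k =
  restrict-⤖ (λ {π} → InRA-irrelevant n k π) (λ {p} → InHA-irrelevant n k p)
             encode decode encode-correct decode-correct
  where
  encode-correct : ∀ {π} → InRA n k π → InHA n k (encode π) × decode (encode π) ≡ π
  encode-correct {π} π∈RA = to (Codes⇒InRA⇔InHA n k codes) π∈RA , Codes⇒decode≡ codes
    where
    codes : Codes (encode π) π
    codes = RA⇒Codes n k π∈RA
  decode-correct : ∀ {p} → InHA n k p → InRA n k (decode p) × encode (decode p) ≡ p
  decode-correct {σ , i} p∈HA@(σ∈Q , _) =
    from (Codes⇒InRA⇔InHA n k codes) p∈HA , Codes⇒encode≡ σ≥1 codes
    where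
    codes : Codes (σ , i) (decode (σ , i))
    codes = HA⇒Codes n k p∈HA
    σ≥1 : All (1 ≤_) σ
    σ≥1 = isPerm⇒positive σ (inQ+1⇒isPerm n k σ σ∈Q)
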